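{- Let $k\ge6$ be an integer and define the sets of integers $X=\{0,3,5,k+3,k+4,k+5\}\cup\{7,8,\dots,k\}$ and $Y=\{0,2,4,5,k+4,k+5\}\cup\{7,8,\dots,k\}$ (where $\{7,\dots,k\}$ is empty if $k=6$). Then $\Delta(X)=\Delta(Y)$ as multisets of integers.
   Context: For a finite set of integers $X=\{x_1,\dots,x_k\}$, $\Delta(X)$ denotes the multiset of the $k^2$ integers $x_i-x_j$, $1\le i,j\le k$. -}

module Defs where

open import Data.Nat using (ℕ; suc; _∸_)
open import Data.Integer using (ℤ; +_; _-_)
open import Data.List using (List; _∷_; []; _++_; map; concatMap; upTo)

-- Δ(X): the multiset (as a list, up to permutation) of the k² differences x_i - x_j,
-- where the finite set X is given as a duplicate-free list of its elements.
Δ : List ℤ → List ℤ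
Δ xs = concatMap (λ x → map (λ y → x - y) xs) xs

interval : ℕ → ℕ → List ℤ
interval a b = map (λ i → + (a Data.Nat.+ i)) (upTo (suc b ∸ a))

setX : ℕ → List ℤ
setX k = + 0 ∷ + 3 ∷ + 5 ∷ + (k Data.Nat.+ 3) ∷ + (k Data.Nat.+ 4) ∷ + (k Data.Nat.+ 5) ∷ interval 7 k

setY : ℕ → List ℤ
setY k = + 0 ∷ + 2 ∷ + 4 ∷ + 5 ∷ + (k Data.Nat.+ 4) ∷ + (k Data.Nat.+ 5) ∷ interval 7 k

-- Write X = X₀ ∪ I and Y = Y₀ ∪ I with I = {7, …, k}.  Then Δ(X) consists of
-- Δ(X₀), Δ(I) and, for each x ∈ X₀, the cross differences ±(I − x), a symmetric
-- run ±{7 − x, …, k − x}.  Treating k as a formal symbol, Δ(X₀) and Δ(Y₀) agree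
-- except for ±(k − 2) against ±4, and the runs agree except for those starting at
-- 4 and 4 − k against those starting at 5 and 3.  These remainders coincide:
-- ±{4 − k, …, −3} = ±{3, …, k − 4}, and ±{4, …, k − 3} ∪ ±(k − 2) = ±4 ∪ ±{5, …, k − 2}.
module Submission where

open import Data.Nat.Base as ℕ using (ℕ; zero; suc)
open import Data.Nat.Properties using (m≤n⇒∃[o]m+o≡n; m+n∸m≡n)
open import Data.Integer.Base using (ℤ; +_; -_; _+_; _-_; _*_; 0ℤ; 1ℤ; -1ℤ)
open import Data.Integer.Properties
  using (pos-+; *-identityˡ; +-identityˡ; +-identityʳ; +-assoc; ≤-decTotalOrder)
open import Data.Integer.Tactic.RingSolver using (solve-∀)
open import Data.List.Base using (List; []; _∷_; [_]; _++_; map; concatMap; applyUpTo)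
open import Data.List.Properties
  using (++-assoc; ++-identityʳ; map-++; map-∘; map-cong; concatMap-++; concatMap-map;
         concatMap-pure; concatMap-cong)
import Data.List.Relation.Binary.Permutation.Propositional as ↭
open import Data.List.Relation.Binary.Permutation.Propositional
  using (_↭_; refl; prep; swap; ↭-refl; ↭-reflexive; ↭-sym; ↭-trans; ↭-prep;
         module PermutationReasoning)
open import Data.List.Relation.Binary.Permutation.Propositional.Properties
  using (++⁺; ++⁺ˡ; ++⁺ʳ; ++-comm; shifts; shift; drop-∷; map⁺; ∷↭∷ʳ)
import Data.List.Sort.InsertionSort.Base as InsertionSort
import Data.List.Sort.InsertionSort.Properties as InsertionSort
open import Data.Product.Base using (_×_; _,_)
open import Data.Product.Relation.Binary.Lex.NonStrict using (×-decTotalOrder)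
open import Function.Base using (_∘_)
open import Level using (0ℓ)
open import Relation.Binary.Bundles using (DecTotalOrder)
open import Relation.Binary.PropositionalEquality
  using (_≡_; refl; sym; trans; cong; cong₂; module ≡-Reasoning)

open import Defs

private
  variable
    A B C : Set
    xs ys : List A

++-cancelˡ : ∀ (zs : List A) → zs ++ xs ↭ zs ++ ys → xs ↭ ys
++-cancelˡ []       p = p
++-cancelˡ (z ∷ zs) p = ++-cancelˡ zs (drop-∷ p)

++-cancelʳ : ∀ (zs : List A) → xs ++ zs ↭ ys ++ zs → xs ↭ ys
++-cancelʳ {xs = xs} {ys = ys} zs p =
  ++-cancelˡ zs (↭-trans (++-comm zs xs) (↭-trans p (++-comm ys zs)))

++-interchange : (ws xs ys zs : List A) → (ws ++ xs) ++ (ys ++ zs) ↭ (ws ++ ys) ++ (xs ++ zs)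
++-interchange ws xs ys zs = begin
  (ws ++ xs) ++ (ys ++ zs)  ≡⟨ ++-assoc ws xs _ ⟩
  ws ++ xs ++ ys ++ zs      ↭⟨ ++⁺ˡ ws (shifts xs ys) ⟩
  ws ++ ys ++ xs ++ zs      ≡⟨ ++-assoc ws ys _ ⟨
  (ws ++ ys) ++ (xs ++ zs)  ∎
  where open PermutationReasoning

∷-++-∷ : ∀ (x y : A) xs ys → (x ∷ xs) ++ (y ∷ ys) ↭ x ∷ y ∷ xs ++ ys
∷-++-∷ x y xs ys = ↭-prep x (shift y xs ys)

concatMap⁺ : (f : A → List B) → xs ↭ ys → concatMap f xs ↭ concatMap f ys
concatMap⁺ f refl          = ↭-refl
concatMap⁺ f (prep x p)    = ++⁺ˡ (f x) (concatMap⁺ f p)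
concatMap⁺ f (swap x y p)  =
  ↭-trans (shifts (f x) (f y)) (++⁺ˡ (f y) (++⁺ˡ (f x) (concatMap⁺ f p)))
concatMap⁺ f (↭.trans p q) = ↭-trans (concatMap⁺ f p) (concatMap⁺ f q)

concatMap-++-↭ : (f g : A → List B) (xs : List A) →
                 concatMap (λ x → f x ++ g x) xs ↭ concatMap f xs ++ concatMap g xs
concatMap-++-↭ f g []       = ↭-refl
concatMap-++-↭ f g (x ∷ xs) = begin
  (f x ++ g x) ++ concatMap (λ x → f x ++ g x) xs   ≡⟨ ++-assoc (f x) _ _ ⟩
  f x ++ g x ++ concatMap (λ x → f x ++ g x) xs     ↭⟨ ++⁺ˡ (f x) (++⁺ˡ (g x) (concatMap-++-↭ f g xs)) ⟩
  f x ++ g x ++ concatMap f xs ++ concatMap g xs    ↭⟨ ++⁺ˡ (f x) (shifts (g x) (concatMap f xs)) ⟩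
  f x ++ concatMap f xs ++ g x ++ concatMap g xs    ≡⟨ ++-assoc (f x) _ _ ⟨
  (f x ++ concatMap f xs) ++ g x ++ concatMap g xs  ∎
  where open PermutationReasoning

map-as-concatMap : (f : A → B) (xs : List A) → map f xs ≡ concatMap (λ x → [ f x ]) xs
map-as-concatMap f xs = trans (sym (concatMap-pure (map f xs))) (concatMap-map [_] f xs)

sort-≡⇒↭ : ∀ {a ℓ₁ ℓ₂} (O : DecTotalOrder a ℓ₁ ℓ₂) {xs ys} →
           InsertionSort.sort O xs ≡ InsertionSort.sort O ys → xs ↭ ys
sort-≡⇒↭ O {xs} {ys} eq =
  ↭-trans (↭-sym (InsertionSort.sort-↭ O xs))
          (↭-trans (↭-reflexive eq) (InsertionSort.sort-↭ O ys))

-- Δ xs is definitionally table _-_ xs xs.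
table : (A → B → C) → List A → List B → List C
table f xs ys = concatMap (λ x → map (f x) ys) xs

table-transpose : (f : A → B → C) (xs : List A) (ys : List B) →
                  table f xs ys ↭ table (λ y x → f x y) ys xs
table-transpose f [] ys = ↭-reflexive (sym (no-columns ys))
  where
  no-columns : ∀ ys → table (λ y x → f x y) ys [] ≡ []
  no-columns []       = refl
  no-columns (_ ∷ ys) = no-columns ys
table-transpose f (x ∷ xs) ys = begin
  map (f x) ys ++ table f xs ys
    ↭⟨ ++⁺ˡ (map (f x) ys) (table-transpose f xs ys) ⟩
  map (f x) ys ++ table (λ y x → f x y) ys xs
    ≡⟨ cong (_++ _) (map-as-concatMap (f x) ys) ⟩
  concatMap (λ y → [ f x y ]) ys ++ table (λ y x → f x y) ys xs
    ↭⟨ concatMap-++-↭ (λ y → [ f x y ]) (λ y → map (λ x → f x y) xs) ys ⟨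
  table (λ y x → f x y) ys (x ∷ xs)
    ∎
  where open PermutationReasoning

table-++ʳ : (f : A → B → C) (xs : List A) (ys zs : List B) →
            table f xs (ys ++ zs) ↭ table f xs ys ++ table f xs zs
table-++ʳ f xs ys zs = begin
  table f xs (ys ++ zs)                              ≡⟨ concatMap-cong (λ x → map-++ (f x) ys zs) xs ⟩
  concatMap (λ x → map (f x) ys ++ map (f x) zs) xs  ↭⟨ concatMap-++-↭ (λ x → map (f x) ys) (λ x → map (f x) zs) xs ⟩
  table f xs ys ++ table f xs zs                     ∎
  where open PermutationReasoning

table-map : (f : A → A → A) (g : B → B → B) (h : A → B) → (∀ x y → h (f x y) ≡ g (h x) (h y)) →
            ∀ xs ys → table g (map h xs) (map h ys) ≡ map h (table f xs ys)
table-map f g h hom []       ys = refl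
table-map f g h hom (x ∷ xs) ys = begin
  map (g (h x)) (map h ys) ++ table g (map h xs) (map h ys)  ≡⟨ cong₂ _++_ row (table-map f g h hom xs ys) ⟩
  map h (map (f x) ys) ++ map h (table f xs ys)              ≡⟨ map-++ h (map (f x) ys) _ ⟨
  map h (map (f x) ys ++ table f xs ys)                      ∎
  where
  open ≡-Reasoning
  row : map (g (h x)) (map h ys) ≡ map h (map (f x) ys)
  row = trans (sym (map-∘ ys)) (trans (map-cong (λ y → sym (hom x y)) ys) (map-∘ ys))

Δ-++ : (xs ys : List ℤ) → Δ (xs ++ ys) ↭ (Δ xs ++ Δ ys) ++ (table _-_ xs ys ++ table _-_ ys xs)
Δ-++ xs ys = begin
  Δ (xs ++ ys)                                            ≡⟨ concatMap-++ _ xs ys ⟩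
  table _-_ xs (xs ++ ys) ++ table _-_ ys (xs ++ ys)      ↭⟨ ++⁺ (table-++ʳ _-_ xs xs ys) (table-++ʳ _-_ ys xs ys) ⟩
  (Δ xs ++ table _-_ xs ys) ++ (table _-_ ys xs ++ Δ ys)  ↭⟨ ++⁺ˡ (Δ xs ++ _) (++-comm (table _-_ ys xs) (Δ ys)) ⟩
  (Δ xs ++ table _-_ xs ys) ++ (Δ ys ++ table _-_ ys xs)  ↭⟨ ++-interchange (Δ xs) _ (Δ ys) _ ⟩
  (Δ xs ++ Δ ys) ++ (table _-_ xs ys ++ table _-_ ys xs)  ∎
  where open PermutationReasoning

run : ℤ → ℕ → List ℤ
run x zero    = []
run x (suc n) = x ∷ run (x + 1ℤ) n

±run : ℤ → ℕ → List ℤ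
±run x n = map -_ (run x n) ++ run x n

+-suc : ∀ x n → x + + suc n ≡ x + 1ℤ + + n
+-suc x n = trans (cong (λ j → x + j) (pos-+ 1 n)) (sym (+-assoc x 1ℤ (+ n)))

map-applyUpTo-run : ∀ n x (f : ℕ → ℤ) (g : ℕ → ℕ) → (∀ i → f (g i) ≡ x + + i) →
                    map f (applyUpTo g n) ≡ run x n
map-applyUpTo-run zero    x f g eq = refl
map-applyUpTo-run (suc n) x f g eq =
  cong₂ _∷_ (trans (eq 0) (+-identityʳ x))
            (map-applyUpTo-run n (x + 1ℤ) f (g ∘ suc) λ i → trans (eq (suc i)) (+-suc x i))

interval-run : ∀ a n → interval (suc a) (a ℕ.+ n) ≡ run (+ suc a) n
interval-run a n rewrite m+n∸m≡n a n =
  map-applyUpTo-run n (+ suc a) _ (λ i → i) (pos-+ (suc a))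

run-∷ʳ : ∀ x n → run x (suc n) ≡ run x n ++ [ x + + n ]
run-∷ʳ x zero    = cong [_] (sym (+-identityʳ x))
run-∷ʳ x (suc n) = cong (x ∷_) (trans (run-∷ʳ (x + 1ℤ) n)
                                      (cong (λ z → run (x + 1ℤ) n ++ [ z ]) (sym (+-suc x n))))

run-sucʳ : ∀ x n → run x (suc n) ↭ x + + n ∷ run x n
run-sucʳ x n = ↭-trans (↭-reflexive (run-∷ʳ x n)) (↭-sym (∷↭∷ʳ (x + + n) (run x n)))

map-run-minus : ∀ a x n → map (_- a) (run x n) ≡ run (x - a) n
map-run-minus a x zero    = refl
map-run-minus a x (suc n) =
  cong (x - a ∷_) (trans (map-run-minus a (x + 1ℤ) n) (cong (λ z → run z n) (comm x a)))
  where
  comm : ∀ x a → x + 1ℤ - a ≡ x - a + 1ℤ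
  comm = solve-∀

map-neg-run : ∀ x n → map -_ (run x n) ↭ run (1ℤ - (x + + n)) n
map-neg-run x zero    = ↭-refl
map-neg-run x (suc n) = begin
  - x ∷ map -_ (run (x + 1ℤ) n)     ↭⟨ ↭-prep (- x) (map-neg-run (x + 1ℤ) n) ⟩
  - x ∷ run y n                     ↭⟨ ∷↭∷ʳ (- x) (run y n) ⟩
  run y n ++ [ - x ]                ≡⟨ cong (λ z → run y n ++ [ z ]) (last x (+ n)) ⟨
  run y n ++ [ y + + n ]            ≡⟨ run-∷ʳ y n ⟨
  run y (suc n)                     ≡⟨ cong (λ z → run (1ℤ - z) (suc n)) (+-suc x n) ⟨
  run (1ℤ - (x + + suc n)) (suc n)  ∎
  where
  open PermutationReasoning
  y = 1ℤ - (x + 1ℤ + + n)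
  last : ∀ x j → 1ℤ - (x + 1ℤ + j) + j ≡ - x
  last = solve-∀

±run-reflect : ∀ x n → ±run (1ℤ - (x + + n)) n ↭ ±run x n
±run-reflect x n = begin
  map -_ (run y n) ++ run y n                  ↭⟨ ++⁺ (map-neg-run y n) (↭-sym (map-neg-run x n)) ⟩
  run (1ℤ - (y + + n)) n ++ map -_ (run x n)  ≡⟨ cong (λ z → run z n ++ map -_ (run x n)) (involutive x (+ n)) ⟩
  run x n ++ map -_ (run x n)                  ↭⟨ ++-comm (run x n) _ ⟩
  map -_ (run x n) ++ run x n                  ∎
  where
  open PermutationReasoning
  y = 1ℤ - (x + + n)
  involutive : ∀ x j → 1ℤ - (1ℤ - (x + j) + j) ≡ x
  involutive = solve-∀

±run-sucʳ : ∀ x n → ±run x (suc n) ↭ - (x + + n) ∷ x + + n ∷ ±run x n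
±run-sucʳ x n = ↭-trans (++⁺ (map⁺ -_ (run-sucʳ x n)) (run-sucʳ x n)) (∷-++-∷ _ _ _ _)

±run-sucˡ : ∀ x n → ±run x (suc n) ↭ - x ∷ x ∷ ±run (x + 1ℤ) n
±run-sucˡ x n = ∷-++-∷ _ _ _ _

cross-differences-run : ∀ x n (xs : List ℤ) →
  table _-_ xs (run x n) ++ table _-_ (run x n) xs ↭ concatMap (λ a → ±run (x - a) n) xs
cross-differences-run x n xs = begin
  table _-_ xs r ++ table _-_ r xs                    ↭⟨ ++⁺ˡ (table _-_ xs r) (table-transpose _-_ r xs) ⟩
  table _-_ xs r ++ table (λ a y → y - a) xs r        ↭⟨ concatMap-++-↭ (λ a → map (_-_ a) r) (λ a → map (_- a) r) xs ⟨
  concatMap (λ a → map (_-_ a) r ++ map (_- a) r) xs  ≡⟨ concatMap-cong row xs ⟩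
  concatMap (λ a → ±run (x - a) n) xs                 ∎
  where
  open PermutationReasoning
  r = run x n
  neg-minus : ∀ y a → - (y - a) ≡ a - y
  neg-minus = solve-∀
  row : ∀ a → map (_-_ a) r ++ map (_- a) r ≡ ±run (x - a) n
  row a = cong₂ _++_
    (trans (map-cong (λ y → sym (neg-minus y a)) r) (trans (map-∘ r) (cong (map (-_)) (map-run-minus a x n))))
    (map-run-minus a x n)

-- (a , b) stands for a · k + b, with k kept as a formal parameter.
Lin : Set
Lin = ℤ × ℤ

⟦_⟧ : Lin → ℕ → ℤ
⟦ a , b ⟧ k = a * + k + b

_⊖_ : Lin → Lin → Lin
(a , b) ⊖ (c , d) = a - c , b - d

constant : ℤ → Lin
constant b = 0ℤ , b

k+ : ℤ → Lin
k+ b = 1ℤ , b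

⟦⊖⟧ : ∀ k u v → ⟦ u ⊖ v ⟧ k ≡ ⟦ u ⟧ k - ⟦ v ⟧ k
⟦⊖⟧ k (a , b) (c , d) = linear a b c d (+ k)
  where
  linear : ∀ a b c d K → (a - c) * K + (b - d) ≡ (a * K + b) - (c * K + d)
  linear = solve-∀

⟦constant⟧ : ∀ k b → ⟦ constant b ⟧ k ≡ b
⟦constant⟧ k b = +-identityˡ b

⟦k+⟧ : ∀ k n → + (k ℕ.+ n) ≡ ⟦ k+ (+ n) ⟧ k
⟦k+⟧ k n = trans (pos-+ k n) (cong (λ j → j + + n) (sym (*-identityˡ (+ k))))

lexicographic : DecTotalOrder 0ℓ 0ℓ 0ℓ
lexicographic = ×-decTotalOrder ≤-decTotalOrder ≤-decTotalOrder

expand : ℕ → ℕ → List Lin → List Lin → List ℤ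
expand k n points starts = map (λ p → ⟦ p ⟧ k) points ++ concatMap (λ s → ±run (⟦ s ⟧ k) n) starts

expand-++ : ∀ k n P P′ S S′ → expand k n (P ++ P′) (S ++ S′) ↭ expand k n P S ++ expand k n P′ S′
expand-++ k n P P′ S S′ =
  ↭-trans (↭-reflexive (cong₂ _++_ (map-++ _ P P′) (concatMap-++ _ S S′)))
          (++-interchange (map (λ p → ⟦ p ⟧ k) P) _ _ _)

expand⁺ : ∀ k n {P P′ S S′} → P ↭ P′ → S ↭ S′ → expand k n P S ↭ expand k n P′ S′
expand⁺ k n p q = ++⁺ (map⁺ _ p) (concatMap⁺ _ q)

Δ-++-run : ∀ k x n (A : List Lin) →
  Δ (map (λ a → ⟦ a ⟧ k) A ++ run x n) ↭
  expand k n (table _⊖_ A A) (map (constant x ⊖_) A) ++ Δ (run x n)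
Δ-++-run k x n A = begin
  Δ (u ++ r)                                        ↭⟨ Δ-++ u r ⟩
  (Δ u ++ Δ r) ++ (table _-_ u r ++ table _-_ r u)  ↭⟨ ++⁺ˡ (Δ u ++ Δ r) (cross-differences-run x n u) ⟩
  (Δ u ++ Δ r) ++ cross                             ≡⟨ ++-assoc (Δ u) (Δ r) cross ⟩
  Δ u ++ Δ r ++ cross                               ↭⟨ ++⁺ˡ (Δ u) (++-comm (Δ r) cross) ⟩
  Δ u ++ cross ++ Δ r                               ≡⟨ ++-assoc (Δ u) cross (Δ r) ⟨
  (Δ u ++ cross) ++ Δ r                             ≡⟨ cong (_++ Δ r) (cong₂ _++_ differences runs) ⟩
  expand k n (table _⊖_ A A) (map (constant x ⊖_) A) ++ Δ r ∎
  where
  open PermutationReasoning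
  u = map (λ a → ⟦ a ⟧ k) A
  r = run x n
  cross = concatMap (λ a → ±run (x - a) n) u
  differences : Δ u ≡ map (λ a → ⟦ a ⟧ k) (table _⊖_ A A)
  differences = table-map _⊖_ _-_ (λ a → ⟦ a ⟧ k) (⟦⊖⟧ k) A A
  run-start : ∀ a → x - ⟦ a ⟧ k ≡ ⟦ constant x ⊖ a ⟧ k
  run-start a = sym (trans (⟦⊖⟧ k (constant x) a) (cong (λ z → z - ⟦ a ⟧ k) (⟦constant⟧ k x)))
  runs : cross ≡ concatMap (λ s → ±run (⟦ s ⟧ k) n) (map (constant x ⊖_) A)
  runs = trans (concatMap-map _ _ A)
               (trans (concatMap-cong (λ a → cong (λ z → ±run z n) (run-start a)) A)
                      (sym (concatMap-map _ _ A)))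

X₀ Y₀ : List Lin
X₀ = constant 0ℤ ∷ constant (+ 3) ∷ constant (+ 5) ∷ k+ (+ 3) ∷ k+ (+ 4) ∷ k+ (+ 5) ∷ []
Y₀ = constant 0ℤ ∷ constant (+ 2) ∷ constant (+ 4) ∷ constant (+ 5) ∷ k+ (+ 4) ∷ k+ (+ 5) ∷ []

setX-split : ∀ m → setX (6 ℕ.+ m) ≡ map (λ a → ⟦ a ⟧ (6 ℕ.+ m)) X₀ ++ run (+ 7) m
setX-split m = cong₂ (λ xs ys → + 0 ∷ + 3 ∷ + 5 ∷ xs ++ ys)
  (cong₂ _∷_ (⟦k+⟧ k 3) (cong₂ _∷_ (⟦k+⟧ k 4) (cong [_] (⟦k+⟧ k 5)))) (interval-run 6 m)
  where k = 6 ℕ.+ m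

setY-split : ∀ m → setY (6 ℕ.+ m) ≡ map (λ a → ⟦ a ⟧ (6 ℕ.+ m)) Y₀ ++ run (+ 7) m
setY-split m = cong₂ (λ xs ys → + 0 ∷ + 2 ∷ + 4 ∷ + 5 ∷ xs ++ ys)
  (cong₂ _∷_ (⟦k+⟧ k 4) (cong [_] (⟦k+⟧ k 5))) (interval-run 6 m)
  where k = 6 ℕ.+ m

pointsX pointsY startsX startsY : List Lin
pointsX = (-1ℤ , + 2) ∷ k+ (- + 2) ∷ []
pointsY = constant (- + 4) ∷ constant (+ 4) ∷ []
startsX = constant (+ 4) ∷ (-1ℤ , + 4) ∷ []
startsY = constant (+ 5) ∷ constant (+ 3) ∷ []

differencesX↭differencesY : table _⊖_ X₀ X₀ ++ pointsY ↭ table _⊖_ Y₀ Y₀ ++ pointsX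
differencesX↭differencesY = sort-≡⇒↭ lexicographic refl

startsX↭startsY : map (constant (+ 7) ⊖_) X₀ ++ startsY ↭ map (constant (+ 7) ⊖_) Y₀ ++ startsX
startsX↭startsY = sort-≡⇒↭ lexicographic refl

run-exchange : ∀ m → expand (6 ℕ.+ m) m pointsX startsX ↭ expand (6 ℕ.+ m) m pointsY startsY
run-exchange m = begin
  ⟦ -1ℤ , + 2 ⟧ k ∷ ⟦ k+ (- + 2) ⟧ k ∷ ±run (+ 4) m ++ ±run (⟦ -1ℤ , + 4 ⟧ k) m ++ []
    ≡⟨ cong₂ (λ p q → p ∷ q ∷ ±run (+ 4) m ++ ±run (⟦ -1ℤ , + 4 ⟧ k) m ++ [])
             (at-k -1ℤ (+ 2) (λ j → - (+ 4 + j)) solve-∀) (at-k 1ℤ (- + 2) (λ j → + 4 + j) solve-∀) ⟩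
  - c ∷ c ∷ ±run (+ 4) m ++ ±run (⟦ -1ℤ , + 4 ⟧ k) m ++ []
    ≡⟨ cong (λ z → - c ∷ c ∷ ±run (+ 4) m ++ z)
            (trans (++-identityʳ _) (cong (λ z → ±run z m) (at-k -1ℤ (+ 4) (λ j → 1ℤ - (+ 3 + j)) solve-∀))) ⟩
  (- c ∷ c ∷ ±run (+ 4) m) ++ ±run (1ℤ - (+ 3 + + m)) m
    ↭⟨ ++⁺ (↭-sym (±run-sucʳ (+ 4) m)) (±run-reflect (+ 3) m) ⟩
  ±run (+ 4) (suc m) ++ ±run (+ 3) m
    ↭⟨ ++⁺ʳ (±run (+ 3) m) (±run-sucˡ (+ 4) m) ⟩
  - + 4 ∷ + 4 ∷ ±run (+ 5) m ++ ±run (+ 3) m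
    ≡⟨ cong (λ z → - + 4 ∷ + 4 ∷ ±run (+ 5) m ++ z) (++-identityʳ _) ⟨
  expand k m pointsY startsY
    ∎
  where
  open PermutationReasoning
  k = 6 ℕ.+ m
  c = + 4 + + m
  at-k : ∀ a b (z : ℤ → ℤ) → (∀ j → a * (+ 6 + j) + b ≡ z j) → ⟦ a , b ⟧ k ≡ z (+ m)
  at-k a b z eq = trans (cong (λ K → a * K + b) (pos-+ 6 m)) (eq (+ m))

expandX↭expandY : ∀ m → let k = 6 ℕ.+ m in
  expand k m (table _⊖_ X₀ X₀) (map (constant (+ 7) ⊖_) X₀) ↭
  expand k m (table _⊖_ Y₀ Y₀) (map (constant (+ 7) ⊖_) Y₀)
expandX↭expandY m = ++-cancelʳ (expand k m pointsY startsY) (begin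
  expand k m PX SX ++ expand k m pointsY startsY  ↭⟨ expand-++ k m PX pointsY SX startsY ⟨
  expand k m (PX ++ pointsY) (SX ++ startsY)      ↭⟨ expand⁺ k m differencesX↭differencesY startsX↭startsY ⟩
  expand k m (PY ++ pointsX) (SY ++ startsX)      ↭⟨ expand-++ k m PY pointsX SY startsX ⟩
  expand k m PY SY ++ expand k m pointsX startsX  ↭⟨ ++⁺ˡ (expand k m PY SY) (run-exchange m) ⟩
  expand k m PY SY ++ expand k m pointsY startsY  ∎)
  where
  open PermutationReasoning
  k = 6 ℕ.+ m
  PX = table _⊖_ X₀ X₀
  PY = table _⊖_ Y₀ Y₀
  SX = map (constant (+ 7) ⊖_) X₀
  SY = map (constant (+ 7) ⊖_) Y₀

proposition8p1 : (k : ℕ) → 6 ℕ.≤ k → Δ (setX k) ↭ Δ (setY k)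
proposition8p1 k 6≤k with m≤n⇒∃[o]m+o≡n 6≤k
... | m , refl = begin
  Δ (setX k)                                                       ≡⟨ cong Δ (setX-split m) ⟩
  Δ (map (λ a → ⟦ a ⟧ k) X₀ ++ run (+ 7) m)                        ↭⟨ Δ-++-run k (+ 7) m X₀ ⟩
  expand k m (table _⊖_ X₀ X₀) (map (constant (+ 7) ⊖_) X₀) ++ ΔI  ↭⟨ ++⁺ʳ ΔI (expandX↭expandY m) ⟩
  expand k m (table _⊖_ Y₀ Y₀) (map (constant (+ 7) ⊖_) Y₀) ++ ΔI  ↭⟨ Δ-++-run k (+ 7) m Y₀ ⟨
  Δ (map (λ a → ⟦ a ⟧ k) Y₀ ++ run (+ 7) m)                        ≡⟨ cong Δ (setY-split m) ⟨
  Δ (setY k)                                                       ∎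
  where
  open PermutationReasoning
  ΔI = Δ (run (+ 7) m)
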